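{- Let $G=(X,E)$ be a binary graph (with $X\subseteq\{0,1\}^n$) that admits a genlex Hamilton path $L=x_1,\dots,x_\ell$. Then Algorithm G with tiebreaking rule $\tau_L$ and initial vertex $\tilde x:=x_1$ computes the path $L$, i.e., it visits $x_1,\dots,x_\ell$ in this order.
   Context: A binary graph is a graph $G=(X,E)$ with $X\subseteq\{0,1\}^n$ for some $n$; $E(x)$ denotes the set of neighbors of $x$. For distinct $x,y\in\{0,1\}^n$ let $\lambda(x,y):=\max\{i\in[n]: x_i\neq y_i\}$. An ordering of $X$ (a sequence containing each element once) is genlex if, for every $k$, all elements of $X$ with the same suffix of length $k$ appear consecutively; a genlex Hamilton path is a Hamilton path of $G$ whose vertex sequence is a genlex ordering. For an ordering $L$ of $X$, the tiebreaking rule $\tau_L$ returns, for a nonempty set $N\subseteq X$, the element of $N$ that appears first in $L$. Algorithm G (input: $G$, initial vertex $\tilde x$, a tiebreaking rule): (G1) set $x:=\tilde x$. (G2) Visit $x$. (G3) Let $N$ be the set of not yet visited neighbors $y\in E(x)$ of $x$ that minimize $\lambda(x,y)$ among all not yet visited neighbors; terminate if $N=\emptyset$. (G4) Pick $y\in N$ by the tiebreaking rule, set $x:=y$ and go to (G2). -}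

module Defs where

open import Data.Bool using (Bool)
open import Data.Empty using (⊥)
open import Data.Nat using (ℕ; zero; suc; _≤_; _⊔_; _∸_)
open import Data.Fin as Fin using (Fin; toℕ)
open import Data.Vec as Vec using (Vec)
open import Data.List using (List; []; _∷_; _++_; length; lookup; foldr; map; allFin)
open import Data.List.Membership.Propositional using (_∈_; _∉_)
open import Data.List.Relation.Unary.Unique.Propositional using (Unique)
open import Data.List.Relation.Unary.Linked using (Linked)
open import Data.Product using (Σ; _×_; ∃₂)
open import Relation.Binary.PropositionalEquality using (_≡_; _≢_)
open import Relation.Nullary using (¬_; Dec; yes; no)
open import Data.Bool.Properties using () renaming (_≟_ to _≟B_)
open import Function.Bundles using (_⇔_)

-- binary strings of length n: x = (x_1,...,x_n), coordinate x_i is  Vec.lookup x (i-1)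
BinStr : ℕ → Set
BinStr n = Vec Bool n

-- λ(x,y) = max { i ∈ [n] : x_i ≠ y_i }  (1-based; equals 0 if x = y, never used then)
lam : ∀ {n} → BinStr n → BinStr n → ℕ
lam {n} x y = foldr _⊔_ 0 (map f (allFin n))
  where
  f : Fin n → ℕ
  f i with Vec.lookup x i ≟B Vec.lookup y i
  ... | yes _ = 0
  ... | no  _ = suc (toℕ i)

record BinGraph (n : ℕ) : Set₁ where
  field
    X      : List (BinStr n)
    E      : BinStr n → BinStr n → Set
    E-sym  : ∀ {x y} → E x y → E y x
    E-irr  : ∀ {x} → ¬ E x x
    E-in   : ∀ {x y} → E x y → x ∈ X × y ∈ X
open BinGraph public

SameSuffix : ∀ {n} → ℕ → BinStr n → BinStr n → Set
SameSuffix {n} k x y = ∀ (i : Fin n) → n ∸ k ≤ toℕ i → Vec.lookup x i ≡ Vec.lookup y i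

IsOrdering : ∀ {n} → BinGraph n → List (BinStr n) → Set
IsOrdering G L = Unique L × (∀ x → (x ∈ X G) ⇔ (x ∈ L))

IsGenlex : ∀ {n} → List (BinStr n) → Set
IsGenlex L = ∀ (k : ℕ) (i j l : Fin (length L)) → i Fin.< j → j Fin.< l →
  SameSuffix k (lookup L i) (lookup L l) → SameSuffix k (lookup L i) (lookup L j)

IsHamiltonPath : ∀ {n} → BinGraph n → List (BinStr n) → Set
IsHamiltonPath G L = IsOrdering G L × Linked (E G) L

IsGenlexHamiltonPath : ∀ {n} → BinGraph n → List (BinStr n) → Set
IsGenlexHamiltonPath G L = IsHamiltonPath G L × IsGenlex L

UnvisitedNbr : ∀ {n} → BinGraph n → List (BinStr n) → BinStr n → BinStr n → Set
UnvisitedNbr G vis x y = y ∈ X G × E G x y × y ∉ vis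

StepN : ∀ {n} → BinGraph n → List (BinStr n) → BinStr n → BinStr n → Set
StepN G vis x y = UnvisitedNbr G vis x y ×
  (∀ z → UnvisitedNbr G vis x z → lam x y ≤ lam x z)

TauL : ∀ {n} → List (BinStr n) → (BinStr n → Set) → BinStr n → Set
TauL L N y = N y × ∃₂ λ as bs → L ≡ as ++ y ∷ bs × (∀ z → N z → z ∉ as)

-- Run of Algorithm G with tiebreaking rule τ_L:
-- AlgGRun G L vis x rest : current vertex x (just visited), vis = visited
-- vertices so far (including x); the algorithm subsequently visits exactly
-- the vertices of  rest, in this order, and then terminates.
data AlgGRun {n} (G : BinGraph n) (L : List (BinStr n)) :
       List (BinStr n) → BinStr n → List (BinStr n) → Set where
  terminate : ∀ {vis x} → (∀ y → ¬ StepN G vis x y) → AlgGRun G L vis x []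
  step      : ∀ {vis x y rest} → TauL L (StepN G vis x) y →
              AlgGRun G L (y ∷ vis) y rest → AlgGRun G L vis x (y ∷ rest)

AlgGVisits : ∀ {n} → BinGraph n → List (BinStr n) → BinStr n → List (BinStr n) → Set
AlgGVisits G L x̃ [] = ⊥
AlgGVisits G L x̃ (x ∷ xs) = x ≡ x̃ × AlgGRun G L (x̃ ∷ []) x̃ xs

{-# OPTIONS --safe #-}
-- If Algorithm G has followed L up to x, so that x and all vertices before it
-- in L are visited, then the successor y of x in L is an unvisited neighbour,
-- and every other unvisited vertex z lies after y in L.  Since x and z agree on
-- their suffix of length n − λ(x,z), the genlex property forces x and y to agree
-- on it as well, i.e. λ(x,y) ≤ λ(x,z).  So y lies in the set N of step (G3), and
-- it comes first in L among N because everything before it is visited.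
module Submission where

open import Defs
open import Data.Bool.Properties using () renaming (_≟_ to _≟B_)
open import Data.Empty using (⊥-elim)
open import Data.Fin as Fin using (toℕ)
open import Data.Fin.Properties using (toℕ<n)
open import Data.List using (List; []; _∷_; _ʳ++_; reverse; foldr; map; allFin)
open import Data.List.Properties using (ʳ++-defn)
open import Data.List.Membership.Propositional using (_∈_; _∉_)
open import Data.List.Membership.Propositional.Properties
  using (foldr-selective; ∈-map⁻; ∈-allFin)
open import Data.List.Relation.Unary.Any as Any using (here; there)
open import Data.List.Relation.Unary.Any.Properties using (lookup-index; reverseAcc⁻; reverse⁻)
open import Data.List.Relation.Unary.AllPairs using (_∷_)
open import Data.List.Relation.Unary.Linked as Linked using (Linked)
open import Data.List.Relation.Unary.Unique.Propositional using (Unique)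
open import Data.List.Relation.Unary.Unique.Propositional.Properties using (Unique[x∷xs]⇒x∉xs)
open import Data.Nat using (ℕ; suc; _≤_; _<_; _⊔_; _∸_; z≤n; s≤s)
open import Data.Nat.Properties
  using (⊔-sel; m≤m⊔n; m≤n⊔m; ≤-refl; ≤-reflexive; ≤-trans; ≰⇒>; <⇒≱; m∸[m∸n]≡n)
open import Data.Product using (∃-syntax; _×_; _,_; proj₂)
open import Data.Sum using (_⊎_; inj₁; inj₂)
open import Data.Vec as Vec using ()
open import Function.Base using (_∋_; _∘_; case_of_)
open import Function.Bundles using (Equivalence)
open import Relation.Binary.PropositionalEquality using (_≡_; _≢_; refl; sym; subst; trans)
open import Relation.Nullary using (yes; no)

≤-foldr-⊔-map : ∀ {A : Set} (g : A → ℕ) {xs a} → a ∈ xs → g a ≤ foldr _⊔_ 0 (map g xs)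
≤-foldr-⊔-map g (here refl) = m≤m⊔n _ _
≤-foldr-⊔-map g (there p)   = ≤-trans (≤-foldr-⊔-map g p) (m≤n⊔m _ _)

module _ {n : ℕ} where

  AgreeFrom : ℕ → BinStr n → BinStr n → Set
  AgreeFrom d x y = ∀ i → d ≤ toℕ i → Vec.lookup x i ≡ Vec.lookup y i

  -- The summand function inside lam is local to Defs, so it is reached by
  -- unifying against lam x y (via _∋_) and then splitting on the same test.
  lam-attained : ∀ (x y : BinStr n) →
    lam x y ≡ 0 ⊎ ∃[ i ] Vec.lookup x i ≢ Vec.lookup y i × lam x y ≡ suc (toℕ i)
  lam-attained x y with (lam x y ≡ 0 ⊎ lam x y ∈ map _ (allFin n)) ∋ foldr-selective ⊔-sel 0 _
  ... | inj₁ eq = inj₁ eq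
  ... | inj₂ mem with ∈-map⁻ _ mem
  ...   | i , _ , eq with Vec.lookup x i ≟B Vec.lookup y i
  ...     | yes _  = inj₁ eq
  ...     | no x≢y = inj₂ (i , x≢y , eq)

  <lam : ∀ (x y : BinStr n) i → Vec.lookup x i ≢ Vec.lookup y i → toℕ i < lam x y
  <lam x y i x≢y with (_ ≤ lam x y) ∋ ≤-foldr-⊔-map _ (∈-allFin i)
  ... | le with Vec.lookup x i ≟B Vec.lookup y i
  ...   | yes x≡y = ⊥-elim (x≢y x≡y)
  ...   | no _    = le

  agreeFrom⇒lam≤ : ∀ {d} (x y : BinStr n) → AgreeFrom d x y → lam x y ≤ d
  agreeFrom⇒lam≤ x y agree with lam-attained x y
  ... | inj₁ eq rewrite eq = z≤n
  ... | inj₂ (i , x≢y , eq) rewrite eq = ≰⇒> (x≢y ∘ agree i)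

  lam≤⇒agreeFrom : ∀ {d} (x y : BinStr n) → lam x y ≤ d → AgreeFrom d x y
  lam≤⇒agreeFrom x y lam≤d i d≤i with Vec.lookup x i ≟B Vec.lookup y i
  ... | yes x≡y = x≡y
  ... | no x≢y  = ⊥-elim (<⇒≱ (<lam x y i x≢y) (≤-trans lam≤d d≤i))

  lam≤n : ∀ (x y : BinStr n) → lam x y ≤ n
  lam≤n x y = agreeFrom⇒lam≤ x y (λ i n≤i → ⊥-elim (<⇒≱ (toℕ<n i) n≤i))

  IsGenlex-tail : ∀ {x} {xs : List (BinStr n)} → IsGenlex (x ∷ xs) → IsGenlex xs
  IsGenlex-tail genlex k i j l i<j j<l =
    genlex k (Fin.suc i) (Fin.suc j) (Fin.suc l) (s≤s i<j) (s≤s j<l)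

  genlex-sameSuffix-next : ∀ {x y z : BinStr n} {zs} → IsGenlex (x ∷ y ∷ zs) → z ∈ zs →
    ∀ k → SameSuffix k x z → SameSuffix k x y
  genlex-sameSuffix-next {x} genlex z∈zs k xz =
    genlex k Fin.zero (Fin.suc Fin.zero) (Fin.suc (Fin.suc (Any.index z∈zs)))
      (s≤s z≤n) (s≤s (s≤s z≤n)) (subst (SameSuffix k x) (lookup-index z∈zs) xz)

  genlex-lam-next≤ : ∀ {x y z : BinStr n} {zs} → IsGenlex (x ∷ y ∷ zs) → z ∈ zs →
    lam x y ≤ lam x z
  genlex-lam-next≤ {x} {y} {z} genlex z∈zs =
    subst (lam x y ≤_) d≡lam (agreeFrom⇒lam≤ x y
      (genlex-sameSuffix-next genlex z∈zs k (lam≤⇒agreeFrom x z (≤-reflexive (sym d≡lam)))))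
    where
    k : ℕ
    k = n ∸ lam x z
    d≡lam : n ∸ k ≡ lam x z
    d≡lam = m∸[m∸n]≡n (lam≤n x z)

module _ {A : Set} where

  ʳ++-suffix : ∀ (P : List A → Set) → (∀ {x xs} → P (x ∷ xs) → P xs) →
    ∀ ds {xs} → P (ds ʳ++ xs) → P xs
  ʳ++-suffix P tail []       p = p
  ʳ++-suffix P tail (d ∷ ds) p = tail (ʳ++-suffix P tail ds p)

  ∈-ʳ++⁻ : ∀ ds {xs} {z : A} → z ∈ ds ʳ++ xs → z ∈ ds ⊎ z ∈ xs
  ∈-ʳ++⁻ ds {xs} z∈ with reverseAcc⁻ xs ds z∈
  ... | inj₁ z∈xs = inj₂ z∈xs
  ... | inj₂ z∈ds = inj₁ z∈ds

  Unique-ʳ++-disjoint : ∀ ds {xs} {z : A} → Unique (ds ʳ++ xs) → z ∈ ds → z ∉ xs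
  Unique-ʳ++-disjoint (d ∷ ds) u (here refl) =
    Unique[x∷xs]⇒x∉xs (ʳ++-suffix Unique (λ { (_ ∷ u′) → u′ }) ds u)
  Unique-ʳ++-disjoint (d ∷ ds) u (there z∈ds) = Unique-ʳ++-disjoint ds u z∈ds ∘ there

-- The visited vertices are x ∷ done with done in reverse order of visit,
-- so L ≡ done ʳ++ x ∷ rest and extending the run needs no reassociation.
module AlgorithmGFollows {n} (G : BinGraph n) {L : List (BinStr n)}
  (unique : Unique L) (X⊆L : ∀ {z} → z ∈ X G → z ∈ L)
  (linked : Linked (E G) L) (genlex : IsGenlex L) where

  unvisited∈rest : ∀ vis rest {z} → L ≡ vis ʳ++ rest → z ∈ X G → z ∉ vis → z ∈ rest
  unvisited∈rest vis rest refl z∈X z∉vis with ∈-ʳ++⁻ vis (X⊆L z∈X)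
  ... | inj₁ z∈vis  = ⊥-elim (z∉vis z∈vis)
  ... | inj₂ z∈rest = z∈rest

  next-unvisitedNbr : ∀ x done {y} rest → L ≡ done ʳ++ x ∷ y ∷ rest →
    UnvisitedNbr G (x ∷ done) x y
  next-unvisitedNbr x done {y} rest refl =
    proj₂ (E-in G xy) , xy , λ y∈vis → Unique-ʳ++-disjoint (x ∷ done) unique y∈vis (here refl)
    where
    xy : E G x y
    xy = Linked.head (ʳ++-suffix (Linked (E G)) Linked.tail done linked)

  next-nearest : ∀ x done {y} rest → L ≡ done ʳ++ x ∷ y ∷ rest →
    ∀ z → UnvisitedNbr G (x ∷ done) x z → lam x y ≤ lam x z
  next-nearest x done rest eq z (z∈X , _ , z∉vis) with unvisited∈rest (x ∷ done) _ eq z∈X z∉vis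
  ... | here refl    = ≤-refl
  ... | there z∈rest =
    genlex-lam-next≤ (ʳ++-suffix IsGenlex IsGenlex-tail done (subst IsGenlex eq genlex)) z∈rest

  next-chosen : ∀ x done {y} rest → L ≡ done ʳ++ x ∷ y ∷ rest →
    TauL L (StepN G (x ∷ done) x) y
  next-chosen x done rest eq =
    (next-unvisitedNbr x done rest eq , next-nearest x done rest eq) ,
    reverse (x ∷ done) , rest , trans eq (ʳ++-defn (x ∷ done)) ,
    λ { z ((_ , _ , z∉vis) , _) → z∉vis ∘ reverse⁻ }

  algG-runs-along : ∀ x done rest → L ≡ done ʳ++ x ∷ rest → AlgGRun G L (x ∷ done) x rest
  algG-runs-along x done []         eq = terminate λ { z ((z∈X , _ , z∉vis) , _) →
    case unvisited∈rest (x ∷ done) [] eq z∈X z∉vis of λ () }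
  algG-runs-along x done (y ∷ rest) eq =
    step (next-chosen x done rest eq) (algG-runs-along y (x ∷ done) rest eq)

theorem5 : ∀ {n} (G : BinGraph n) (x₁ : BinStr n) (xs : List (BinStr n)) →
    IsGenlexHamiltonPath G (x₁ ∷ xs) →
    AlgGVisits G (x₁ ∷ xs) x₁ (x₁ ∷ xs)
theorem5 G x₁ xs (((unique , ordering) , linked) , genlex) =
  refl , algG-runs-along x₁ [] xs refl
  where
  open AlgorithmGFollows G unique (Equivalence.to (ordering _)) linked genlex
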